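{- Let $G$ be a graph on $n$ vertices which is the complement of a $c$-closed graph. Then the number of sets $S\subseteq V(G)$ for which either $G[S]$ contains at least two non-trivial connected components, or some connected component of $G[S]$ has diameter at least $6$, is at most $n^4\cdot 2^{2(c-1)}$.
   Context: Graphs are finite, simple and undirected. A graph $H$ is $c$-closed if any two non-adjacent vertices have at most $c-1$ common neighbors; $G$ is the complement of a $c$-closed graph iff for any two adjacent vertices $u,v$ of $G$ at most $c-1$ vertices of $G$ are adjacent to neither $u$ nor $v$ (excluding $u,v$). A connected component is non-trivial if it contains at least two vertices. -}

module Defs where

open import Data.Nat using (ℕ; zero; suc; _<_; _≤_; _∸_)
open import Data.Bool using (Bool; true; false; not; _∧_; if_then_else_)
open import Data.Fin using (Fin)
open import Data.Fin.Properties using (_≟_)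
open import Data.Fin.Subset using (Subset; _∈_; ∣_∣)
open import Data.Vec using (tabulate)
open import Data.Product using (Σ; ∃; _×_; _,_)
open import Relation.Nullary using (¬_; yes; no)
open import Relation.Nullary.Decidable using (⌊_⌋)
open import Relation.Binary.PropositionalEquality using (_≡_; refl; sym; ≢-sym)
open import Data.Sum using (_⊎_)

record Graph (n : ℕ) : Set where
  field
    adj    : Fin n → Fin n → Bool
    adj-sym : ∀ u v → adj u v ≡ adj v u
    adj-irr : ∀ u → adj u u ≡ false
open Graph public

Adj : ∀ {n} → Graph n → Fin n → Fin n → Set
Adj G u v = adj G u v ≡ true

complement : ∀ {n} → Graph n → Graph n
complement {n} G = record { adj = cadj ; adj-sym = csym ; adj-irr = cirr }
  where
  cadj : Fin n → Fin n → Bool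
  cadj u v with u ≟ v
  ... | yes _ = false
  ... | no  _ = not (adj G u v)
  csym : ∀ u v → cadj u v ≡ cadj v u
  csym u v with u ≟ v | v ≟ u
  ... | yes _ | yes _ = refl
  ... | yes p | no ¬q = Data.Empty.⊥-elim (¬q (sym p))
    where import Data.Empty
  ... | no ¬p | yes q = Data.Empty.⊥-elim (¬p (sym q))
    where import Data.Empty
  ... | no _  | no _ rewrite adj-sym G u v = refl
  cirr : ∀ u → cadj u u ≡ false
  cirr u with u ≟ u
  ... | yes _ = refl
  ... | no ¬p = Data.Empty.⊥-elim (¬p refl)
    where import Data.Empty

commonNbrs : ∀ {n} → Graph n → Fin n → Fin n → Subset n
commonNbrs G u v = tabulate (λ w → adj G u w ∧ adj G v w)

CClosed : ∀ {n} → ℕ → Graph n → Set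
CClosed c H = ∀ u v → ¬ (u ≡ v) → adj H u v ≡ false → ∣ commonNbrs H u v ∣ ≤ c ∸ 1

data Walk {n} (G : Graph n) (S : Subset n) : Fin n → Fin n → ℕ → Set where
  nil  : ∀ {u} → u ∈ S → Walk G S u u 0
  cons : ∀ {u w v k} → u ∈ S → Adj G u w → Walk G S w v k → Walk G S u v (suc k)

Connected : ∀ {n} → Graph n → Subset n → Fin n → Fin n → Set
Connected G S u v = ∃ λ k → Walk G S u v k

DistAtLeast : ∀ {n} → Graph n → Subset n → Fin n → Fin n → ℕ → Set
DistAtLeast G S u v d = ∀ k → k < d → ¬ Walk G S u v k

TwoNontrivialComponents : ∀ {n} → Graph n → Subset n → Set
TwoNontrivialComponents G S =
  Σ _ λ x₁ → Σ _ λ y₁ → Σ _ λ x₂ → Σ _ λ y₂ →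
    (x₁ ∈ S × y₁ ∈ S × x₂ ∈ S × y₂ ∈ S) ×
    (¬ x₁ ≡ y₁) × Connected G S x₁ y₁ ×
    (¬ x₂ ≡ y₂) × Connected G S x₂ y₂ ×
    ¬ Connected G S x₁ x₂

SomeComponentDiamAtLeast : ∀ {n} → ℕ → Graph n → Subset n → Set
SomeComponentDiamAtLeast d G S =
  Σ _ λ u → Σ _ λ v → Connected G S u v × DistAtLeast G S u v d

BadSet : ∀ {n} → Graph n → Subset n → Set
BadSet G S = TwoNontrivialComponents G S ⊎ SomeComponentDiamAtLeast 6 G S

-- A bad set S contains edges ab and cd of G[S] such that no vertex of S is
-- within distance 2 of both a and c in G[S]: take an edge at each of two
-- non-trivial components, or an edge at each end of a pair of vertices at
-- distance at least 6. A vertex of S that is not within distance 2 of a is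
-- adjacent in G to neither a nor b, so S lies in the union of the sets of
-- common non-neighbours of a, b and of c, d. These are common neighbours of a
-- non-adjacent pair in the c-closed complement, so each has at most c - 1
-- elements, and each of the n^4 choices of (a, b, c, d) accounts for at most
-- 2^(2(c-1)) bad sets.
module Submission where

open import Defs
open import Data.Nat using (ℕ; _≤_; _*_; _^_; _∸_; suc; _+_; z≤n; s≤s)
open import Data.Nat.Properties
  using (≤-trans; ≤-reflexive; +-mono-≤; +-monoʳ-≤; +-suc; +-comm; +-identityʳ;
         m≤m+n; n≤1+n; *-assoc; *-identityʳ; m≤n⇒m≤1+n; ^-monoʳ-≤; module ≤-Reasoning)
open import Data.Bool using (true; false; _∧_; if_then_else_)
open import Data.Empty using (⊥-elim)
open import Data.Fin using (Fin)
open import Data.Fin.Properties using (_≟_)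
open import Data.Fin.Subset using (Subset; ∣_∣; _∪_; ⊥; inside; outside)
  renaming (_∈_ to _∈ₛ_; _⊆_ to _⊆ₛ_)
open import Data.Fin.Subset.Properties using (drop-∷-⊆; x∈p∪q⁺; ∣⊥∣≡0)
open import Data.Vec using ([]; _∷_; here; lookup)
open import Data.Vec.Properties using (lookup∘tabulate; lookup⇒[]=)
open import Data.List using (List; length; map; concatMap; cartesianProduct; allFin)
  renaming ([] to []ₗ; _∷_ to _∷ₗ_; _++_ to _++ₗ_)
open import Data.List.Properties using (length-map; length-++; length-removeAt′; length-tabulate)
open import Data.List.Relation.Unary.All as All using (All)
open import Data.List.Relation.Unary.Any using (here; there)
open import Data.List.Membership.Propositional using (_∈_; _─_)
open import Data.List.Membership.Propositional.Properties
  using (∈-++⁺ˡ; ∈-++⁺ʳ; ∈-map⁺; ∈-concat⁺′; ∈-allFin; ∈-cartesianProduct⁺)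
open import Data.List.Relation.Binary.Subset.Propositional using (_⊆_)
open import Data.List.Relation.Unary.Unique.Propositional using (Unique)
open import Data.List.Relation.Unary.AllPairs using (_∷_)
open import Data.Product using (∃; _×_; _,_; proj₂)
open import Function using (id; _∘_)
open import Data.Sum using (_⊎_; inj₁; inj₂)
open import Relation.Nullary using (¬_; yes; no)
open import Relation.Binary.PropositionalEquality

∈-─⁺ : ∀ {A : Set} {x y : A} {xs} (x∈xs : x ∈ xs) → y ∈ xs → x ≢ y → y ∈ xs ─ x∈xs
∈-─⁺ (here refl) (here refl) x≢y = ⊥-elim (x≢y refl)
∈-─⁺ (here refl) (there y∈xs) _ = y∈xs
∈-─⁺ (there x∈xs) (here refl) _ = here refl
∈-─⁺ (there x∈xs) (there y∈xs) x≢y = there (∈-─⁺ x∈xs y∈xs x≢y)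

Unique-⊆⇒length≤ : ∀ {A : Set} {xs ys : List A} → Unique xs → xs ⊆ ys → length xs ≤ length ys
Unique-⊆⇒length≤ {xs = []ₗ} _ _ = z≤n
Unique-⊆⇒length≤ {xs = x ∷ₗ xs} {ys} (x∉xs ∷ unique) xs⊆ys =
  ≤-trans (s≤s (Unique-⊆⇒length≤ unique xs⊆ys─x))
          (≤-reflexive (sym (length-removeAt′ ys _)))
  where
  xs⊆ys─x : xs ⊆ ys ─ xs⊆ys (here refl)
  xs⊆ys─x y∈xs = ∈-─⁺ (xs⊆ys (here refl)) (xs⊆ys (there y∈xs)) (All.lookup x∉xs y∈xs)

length-concatMap-≤ : ∀ {A B : Set} (f : A → List B) {k} → (∀ x → length (f x) ≤ k) →
  ∀ xs → length (concatMap f xs) ≤ length xs * k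
length-concatMap-≤ f bound []ₗ = z≤n
length-concatMap-≤ f bound (x ∷ₗ xs) = begin
  length (f x ++ₗ concatMap f xs)          ≡⟨ length-++ (f x) ⟩
  length (f x) + length (concatMap f xs)   ≤⟨ +-mono-≤ (bound x) (length-concatMap-≤ f bound xs) ⟩
  _                                        ∎
  where open ≤-Reasoning

∈-concatMap⁺ : ∀ {A B : Set} (f : A → List B) {xs x y} → x ∈ xs → y ∈ f x → y ∈ concatMap f xs
∈-concatMap⁺ f x∈xs y∈fx = ∈-concat⁺′ y∈fx (∈-map⁺ f x∈xs)

length-cartesianProduct : ∀ {A B : Set} (xs : List A) (ys : List B) →
  length (cartesianProduct xs ys) ≡ length xs * length ys
length-cartesianProduct []ₗ ys = refl
length-cartesianProduct (x ∷ₗ xs) ys = begin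
  length (map (x ,_) ys ++ₗ cartesianProduct xs ys)
    ≡⟨ length-++ (map (x ,_) ys) ⟩
  length (map (x ,_) ys) + length (cartesianProduct xs ys)
    ≡⟨ cong₂ _+_ (length-map (x ,_) ys) (length-cartesianProduct xs ys) ⟩
  length ys + length xs * length ys ∎
  where open ≡-Reasoning

square-square : ∀ n → (n * n) * (n * n) ≡ n ^ 4
square-square n = begin
  (n * n) * (n * n)   ≡⟨ *-assoc n n (n * n) ⟩
  n * (n * (n * n))   ≡⟨ cong (λ m → n * (n * (n * m))) (sym (*-identityʳ n)) ⟩
  n ^ 4               ∎
  where open ≡-Reasoning

subsetsOf : ∀ {n} → Subset n → List (Subset n)
subsetsOf [] = [] ∷ₗ []ₗ
subsetsOf (false ∷ p) = map (outside ∷_) (subsetsOf p)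
subsetsOf (true ∷ p) = map (outside ∷_) (subsetsOf p) ++ₗ map (inside ∷_) (subsetsOf p)

length-subsetsOf : ∀ {n} (p : Subset n) → length (subsetsOf p) ≡ 2 ^ ∣ p ∣
length-subsetsOf [] = refl
length-subsetsOf (false ∷ p) = trans (length-map _ (subsetsOf p)) (length-subsetsOf p)
length-subsetsOf (true ∷ p) = begin
  length (map (outside ∷_) (subsetsOf p) ++ₗ map (inside ∷_) (subsetsOf p))
    ≡⟨ length-++ (map (outside ∷_) (subsetsOf p)) ⟩
  length (map (outside ∷_) (subsetsOf p)) + length (map (inside ∷_) (subsetsOf p))
    ≡⟨ cong₂ _+_ (length-map _ (subsetsOf p)) (length-map _ (subsetsOf p)) ⟩
  length (subsetsOf p) + length (subsetsOf p)
    ≡⟨ cong₂ _+_ (length-subsetsOf p) (trans (length-subsetsOf p) (sym (+-identityʳ _))) ⟩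
  2 ^ ∣ p ∣ + (2 ^ ∣ p ∣ + 0) ∎
  where open ≡-Reasoning

⊆⇒∈-subsetsOf : ∀ {n} {q p : Subset n} → q ⊆ₛ p → q ∈ subsetsOf p
⊆⇒∈-subsetsOf {q = []} {[]} _ = here refl
⊆⇒∈-subsetsOf {q = false ∷ q} {false ∷ p} q⊆p =
  ∈-map⁺ (outside ∷_) (⊆⇒∈-subsetsOf (drop-∷-⊆ q⊆p))
⊆⇒∈-subsetsOf {q = true ∷ q} {false ∷ p} q⊆p with q⊆p here
... | ()
⊆⇒∈-subsetsOf {q = false ∷ q} {true ∷ p} q⊆p =
  ∈-++⁺ˡ (∈-map⁺ (outside ∷_) (⊆⇒∈-subsetsOf (drop-∷-⊆ q⊆p)))
⊆⇒∈-subsetsOf {q = true ∷ q} {true ∷ p} q⊆p =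
  ∈-++⁺ʳ (map (outside ∷_) (subsetsOf p)) (∈-map⁺ (inside ∷_) (⊆⇒∈-subsetsOf (drop-∷-⊆ q⊆p)))

∣p∪q∣≤∣p∣+∣q∣ : ∀ {n} (p q : Subset n) → ∣ p ∪ q ∣ ≤ ∣ p ∣ + ∣ q ∣
∣p∪q∣≤∣p∣+∣q∣ [] [] = z≤n
∣p∪q∣≤∣p∣+∣q∣ (false ∷ p) (false ∷ q) = ∣p∪q∣≤∣p∣+∣q∣ p q
∣p∪q∣≤∣p∣+∣q∣ (false ∷ p) (true ∷ q) =
  ≤-trans (s≤s (∣p∪q∣≤∣p∣+∣q∣ p q)) (≤-reflexive (sym (+-suc ∣ p ∣ ∣ q ∣)))
∣p∪q∣≤∣p∣+∣q∣ (true ∷ p) (false ∷ q) = s≤s (∣p∪q∣≤∣p∣+∣q∣ p q)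
∣p∪q∣≤∣p∣+∣q∣ (true ∷ p) (true ∷ q) =
  s≤s (≤-trans (∣p∪q∣≤∣p∣+∣q∣ p q) (+-monoʳ-≤ ∣ p ∣ (n≤1+n ∣ q ∣)))

Unique-covered⇒length≤ : ∀ {n} {I : Set} (is : List I) (cover : I → Subset n) {m} →
  (∀ i → ∣ cover i ∣ ≤ m) →
  (Ss : List (Subset n)) → Unique Ss → (∀ {S} → S ∈ Ss → ∃ λ i → i ∈ is × S ⊆ₛ cover i) →
  length Ss ≤ length is * 2 ^ m
Unique-covered⇒length≤ {n} {I} is cover {m} small Ss unique covered =
  ≤-trans (Unique-⊆⇒length≤ unique Ss⊆candidates)
          (length-concatMap-≤ candidates few is)
  where
  candidates : I → List (Subset n)
  candidates i = subsetsOf (cover i)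
  Ss⊆candidates : Ss ⊆ concatMap candidates is
  Ss⊆candidates S∈Ss with covered S∈Ss
  ... | i , i∈is , S⊆cover = ∈-concatMap⁺ candidates i∈is (⊆⇒∈-subsetsOf S⊆cover)
  few : ∀ i → length (candidates i) ≤ 2 ^ m
  few i = ≤-trans (≤-reflexive (length-subsetsOf (cover i))) (^-monoʳ-≤ 2 (small i))

WithinDist : ∀ {n} → Graph n → Subset n → Fin n → Fin n → ℕ → Set
WithinDist G S u v d = ∃ λ k → k ≤ d × Walk G S u v k

module _ {n : ℕ} {G : Graph n} {S : Subset n} where

  Adj-sym : ∀ {u v} → Adj G u v → Adj G v u
  Adj-sym {u} {v} uv = trans (adj-sym G v u) uv

  walk-source∈ : ∀ {u v k} → Walk G S u v k → u ∈ₛ S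
  walk-source∈ (nil u∈S) = u∈S
  walk-source∈ (cons u∈S _ _) = u∈S

  walk-++ : ∀ {u w v k l} → Walk G S u w k → Walk G S w v l → Walk G S u v (k + l)
  walk-++ (nil _) q = q
  walk-++ (cons u∈S uw p) q = cons u∈S uw (walk-++ p q)

  walk-reverse : ∀ {u v k} → Walk G S u v k → Walk G S v u k
  walk-reverse (nil u∈S) = nil u∈S
  walk-reverse {u} {v} {suc k} (cons u∈S uw p) =
    subst (Walk G S v u) (+-comm k 1)
      (walk-++ (walk-reverse p) (cons (walk-source∈ p) (Adj-sym uw) (nil u∈S)))

  walk-firstStep : ∀ {u v k} → u ≢ v → Walk G S u v k → ∃ λ w → Adj G u w × w ∈ₛ S
  walk-firstStep u≢v (nil _) = ⊥-elim (u≢v refl)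
  walk-firstStep _ (cons _ uw p) = _ , uw , walk-source∈ p

  within-join : ∀ {u w v d e} → WithinDist G S u w d → WithinDist G S v w e →
    WithinDist G S u v (d + e)
  within-join (k , k≤d , p) (l , l≤e , q) = k + l , +-mono-≤ k≤d l≤e , walk-++ p (walk-reverse q)

module _ {n : ℕ} (G : Graph n) where

  -- Empty for non-edges, so that its size is bounded for every pair.
  far : Fin n → Fin n → Subset n
  far a b = if adj G a b then commonNbrs (complement G) a b else ⊥

  Adj⇒≢ : ∀ {a b} → Adj G a b → a ≢ b
  Adj⇒≢ {a} ab refl with trans (sym ab) (adj-irr G a)
  ... | ()

  complement-adj-edge : ∀ {a b} → Adj G a b → adj (complement G) a b ≡ false
  complement-adj-edge {a} {b} ab with a ≟ b
  ... | yes _ = refl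
  ... | no _ rewrite ab = refl

  complement-adj-nonedge : ∀ {a w} → a ≢ w → adj G a w ≡ false → Adj (complement G) a w
  complement-adj-nonedge {a} {w} a≢w aw with a ≟ w
  ... | yes a≡w = ⊥-elim (a≢w a≡w)
  ... | no _ rewrite aw = refl

  ∣far∣≤ : ∀ c → CClosed c (complement G) → ∀ a b → ∣ far a b ∣ ≤ c ∸ 1
  ∣far∣≤ c closed a b with adj G a b in ab
  ... | true = closed a b (Adj⇒≢ ab) (complement-adj-edge ab)
  ... | false = ≤-trans (≤-reflexive (∣⊥∣≡0 n)) z≤n

  ∈-far : ∀ {a b w} → Adj G a b → a ≢ w → adj G a w ≡ false → b ≢ w → adj G b w ≡ false →
    w ∈ₛ far a b
  ∈-far {a} {b} {w} ab a≢w aw b≢w bw rewrite ab =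
    lookup⇒[]= w _ (begin
      lookup (commonNbrs (complement G) a b) w
        ≡⟨ lookup∘tabulate _ w ⟩
      adj (complement G) a w ∧ adj (complement G) b w
        ≡⟨ cong₂ _∧_ (complement-adj-nonedge a≢w aw) (complement-adj-nonedge b≢w bw) ⟩
      true ∎)
    where open ≡-Reasoning

  near-or-far : ∀ {S a b w} → Adj G a b → a ∈ₛ S → b ∈ₛ S → w ∈ₛ S →
    WithinDist G S a w 2 ⊎ w ∈ₛ far a b
  near-or-far {a = a} {b} {w} ab a∈S b∈S w∈S
    with a ≟ w | adj G a w in aw | b ≟ w | adj G b w in bw
  ... | yes refl | _ | _ | _ = inj₁ (0 , z≤n , nil a∈S)
  ... | no _ | true | _ | _ = inj₁ (1 , s≤s z≤n , cons a∈S aw (nil w∈S))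
  ... | no _ | false | yes refl | _ = inj₁ (1 , s≤s z≤n , cons a∈S ab (nil b∈S))
  ... | no _ | false | no _ | true = inj₁ (2 , s≤s (s≤s z≤n) , cons a∈S ab (cons b∈S bw (nil w∈S)))
  ... | no a≢w | false | no b≢w | false = inj₂ (∈-far ab a≢w aw b≢w bw)

  Quadruple : Set
  Quadruple = (Fin n × Fin n) × (Fin n × Fin n)

  farFromBoth : Quadruple → Subset n
  farFromBoth ((a , b) , (c , d)) = far a b ∪ far c d

  ∣farFromBoth∣≤ : ∀ c → CClosed c (complement G) → ∀ i → ∣ farFromBoth i ∣ ≤ 2 * (c ∸ 1)
  ∣farFromBoth∣≤ c closed ((a , b) , (a′ , b′)) =
    ≤-trans (∣p∪q∣≤∣p∣+∣q∣ (far a b) (far a′ b′))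
      (+-mono-≤ (∣far∣≤ c closed a b) (≤-trans (∣far∣≤ c closed a′ b′) (m≤m+n (c ∸ 1) 0)))

  vertexPairs : List (Fin n × Fin n)
  vertexPairs = cartesianProduct (allFin n) (allFin n)

  quadruples : List Quadruple
  quadruples = cartesianProduct vertexPairs vertexPairs

  ∈-quadruples : ∀ i → i ∈ quadruples
  ∈-quadruples ((a , b) , (c , d)) =
    ∈-cartesianProduct⁺ (∈-cartesianProduct⁺ (∈-allFin a) (∈-allFin b))
                        (∈-cartesianProduct⁺ (∈-allFin c) (∈-allFin d))

  length-quadruples : length quadruples ≡ n ^ 4
  length-quadruples = begin
    length quadruples
      ≡⟨ length-cartesianProduct vertexPairs vertexPairs ⟩
    length vertexPairs * length vertexPairs
      ≡⟨ cong (λ m → m * m) (trans (length-cartesianProduct (allFin n) (allFin n))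
                                   (cong (λ m → m * m) (length-tabulate {n = n} id))) ⟩
    (n * n) * (n * n)
      ≡⟨ square-square n ⟩
    n ^ 4 ∎
    where open ≡-Reasoning

  far-cover : ∀ {S a b c d} → Adj G a b → a ∈ₛ S → b ∈ₛ S → Adj G c d → c ∈ₛ S → d ∈ₛ S →
    (∀ {w} → WithinDist G S a w 2 → ¬ WithinDist G S c w 2) →
    S ⊆ₛ farFromBoth ((a , b) , (c , d))
  far-cover ab a∈S b∈S cd c∈S d∈S separated w∈S
    with near-or-far ab a∈S b∈S w∈S | near-or-far cd c∈S d∈S w∈S
  ... | inj₂ w∈far | _ = x∈p∪q⁺ (inj₁ w∈far)
  ... | inj₁ _ | inj₂ w∈far = x∈p∪q⁺ (inj₂ w∈far)
  ... | inj₁ near-a | inj₁ near-c = ⊥-elim (separated near-a near-c)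

  TwoNontrivialComponents⇒covered : ∀ {S} → TwoNontrivialComponents G S →
    ∃ λ i → S ⊆ₛ farFromBoth i
  TwoNontrivialComponents⇒covered
    (x₁ , y₁ , x₂ , y₂ , (x₁∈S , _ , x₂∈S , _) , x₁≢y₁ , (_ , p₁) , x₂≢y₂ , (_ , p₂) , x₁≁x₂)
    with walk-firstStep x₁≢y₁ p₁ | walk-firstStep x₂≢y₂ p₂
  ... | z₁ , x₁z₁ , z₁∈S | z₂ , x₂z₂ , z₂∈S =
    _ , far-cover x₁z₁ x₁∈S z₁∈S x₂z₂ x₂∈S z₂∈S
          (λ near₁ near₂ → x₁≁x₂ (_ , proj₂ (proj₂ (within-join near₁ near₂))))

  SomeComponentDiamAtLeast⇒covered : ∀ {S} → SomeComponentDiamAtLeast 6 G S →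
    ∃ λ i → S ⊆ₛ farFromBoth i
  SomeComponentDiamAtLeast⇒covered (u , v , (_ , p) , farApart)
    with walk-firstStep u≢v p | walk-firstStep (u≢v ∘ sym) (walk-reverse p)
    where
    u≢v : u ≢ v
    u≢v refl = farApart 0 (s≤s z≤n) (nil (walk-source∈ p))
  ... | z₁ , uz₁ , z₁∈S | z₂ , vz₂ , z₂∈S =
    _ , far-cover uz₁ (walk-source∈ p) z₁∈S vz₂ (walk-source∈ (walk-reverse p)) z₂∈S
          (λ near₁ near₂ → let k , k≤4 , q = within-join near₁ near₂
                           in farApart k (s≤s (m≤n⇒m≤1+n k≤4)) q)

  BadSet⇒covered : ∀ {S} → BadSet G S → ∃ λ i → S ⊆ₛ farFromBoth i
  BadSet⇒covered (inj₁ twoComponents) = TwoNontrivialComponents⇒covered twoComponents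
  BadSet⇒covered (inj₂ farPair) = SomeComponentDiamAtLeast⇒covered farPair

corollary17 : (n c : ℕ) (G : Graph n) → CClosed c (complement G) →
    (L : List (Subset n)) → Unique L → All (BadSet G) L →
    length L ≤ n ^ 4 * 2 ^ (2 * (c ∸ 1))
corollary17 n c G closed L unique bad = begin
  length L
    ≤⟨ Unique-covered⇒length≤ (quadruples G) (farFromBoth G) (∣farFromBoth∣≤ G c closed) L unique covered ⟩
  length (quadruples G) * 2 ^ (2 * (c ∸ 1))
    ≡⟨ cong (_* 2 ^ (2 * (c ∸ 1))) (length-quadruples G) ⟩
  n ^ 4 * 2 ^ (2 * (c ∸ 1)) ∎
  where
  open ≤-Reasoning
  covered : ∀ {S} → S ∈ L → ∃ λ i → i ∈ quadruples G × S ⊆ₛ farFromBoth G i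
  covered S∈L with BadSet⇒covered G (All.lookup bad S∈L)
  ... | i , S⊆far = i , ∈-quadruples G i , S⊆far
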